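{- Let $Q$ be a query over a $\lambda$-graph $G$. Then $Q^{\Downarrow}$ is a bisimulation if and only if $Q^{\#}$ is a bisimulation.
   Context: A $\lambda$-graph is a finite directed graph with application nodes $\mathrm{App}(n_1,n_2)$, abstraction nodes $\mathrm{Abs}(n)$, free variable nodes (no children) and bound variable nodes $\mathrm{Var}(l)$ with a binding edge to an abstraction node $l$, acyclic when binding edges are ignored, in which every path of child edges from a root (a node with no parents) to $\mathrm{Var}(l)$ passes through $l$. A query is a binary relation on the roots of $G$. Nodes are homogeneous if of the same kind. Rules: ($\swarrow$) $\mathrm{App}(n_1,n_2)\,R\,\mathrm{App}(m_1,m_2)\Rightarrow n_1Rm_1$; ($\searrow$) $\mathrm{App}(n_1,n_2)\,R\,\mathrm{App}(m_1,m_2)\Rightarrow n_2Rm_2$; ($\downarrow$) $\mathrm{Abs}(n)\,R\,\mathrm{Abs}(m)\Rightarrow nRm$; (scoping) $\mathrm{Var}(n)\,R\,\mathrm{Var}(m)\Rightarrow nRm$. A bisimulation is a homogeneous relation closed under all four rules. $Q^{\Downarrow}$ is the closure of $Q$ under ($\swarrow$), ($\searrow$), ($\downarrow$); $Q^{\#}$ is the closure of $Q$ under reflexivity, symmetry, transitivity, ($\swarrow$), ($\searrow$), ($\downarrow$). -}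

module Defs where

open import Data.Nat using (ℕ)
open import Data.Fin using (Fin)
open import Data.Product using (Σ; _×_; ∃)
open import Relation.Binary.PropositionalEquality using (_≡_; _≢_)
open import Relation.Nullary using (¬_)
open import Level using (0ℓ)
open import Relation.Binary.Core using (Rel)

data Label (n : ℕ) : Set where
  app  : Fin n → Fin n → Label n
  abs  : Fin n → Label n
  fvar : Label n
  var  : Fin n → Label n           -- Var(l), binding edge to l

record PreGraph : Set where
  constructor mkPreGraph
  field
    size  : ℕ
    label : Fin size → Label size

module _ (G : PreGraph) where
  open PreGraph G

  Node : Set
  Node = Fin size

  data Child : Node → Node → Set where
    appL : ∀ {p c d} → label p ≡ app c d → Child c p
    appR : ∀ {p c d} → label p ≡ app d c → Child c p
    absB : ∀ {p c}   → label p ≡ abs c   → Child c p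

  data Reach⁺ : Node → Node → Set where
    one  : ∀ {a b}   → Child b a → Reach⁺ a b
    step : ∀ {a b c} → Child b a → Reach⁺ b c → Reach⁺ a c

  data PathAvoiding (l : Node) : Node → Node → Set where
    here : ∀ {a}     → a ≢ l → PathAvoiding l a a
    step : ∀ {a b c} → a ≢ l → Child b a → PathAvoiding l b c → PathAvoiding l a c

  IsRoot : Node → Set
  IsRoot a = ∀ p → ¬ Child a p

  record IsLambdaGraph : Set where
    field
      bindsToAbs : ∀ v l → label v ≡ var l → ∃ λ m → label l ≡ abs m
      acyclic    : ∀ a → ¬ Reach⁺ a a
      scoping    : ∀ r v l → IsRoot r → label v ≡ var l → ¬ PathAvoiding l r v

  IsQuery : Rel Node 0ℓ → Set
  IsQuery Q = ∀ a b → Q a b → IsRoot a × IsRoot b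

  data Kind : Set where
    kApp kAbs kFVar kVar : Kind

  kind : Label size → Kind
  kind (app _ _) = kApp
  kind (abs _)   = kAbs
  kind fvar      = kFVar
  kind (var _)   = kVar

  Homogeneous : Rel Node 0ℓ → Set
  Homogeneous R = ∀ a b → R a b → kind (label a) ≡ kind (label b)

  record IsBisimulation (R : Rel Node 0ℓ) : Set where
    field
      homogeneous : Homogeneous R
      ruleL    : ∀ {a b n₁ n₂ m₁ m₂} → R a b → label a ≡ app n₁ n₂ → label b ≡ app m₁ m₂ → R n₁ m₁
      ruleR    : ∀ {a b n₁ n₂ m₁ m₂} → R a b → label a ≡ app n₁ n₂ → label b ≡ app m₁ m₂ → R n₂ m₂
      ruleAbs  : ∀ {a b n m} → R a b → label a ≡ abs n → label b ≡ abs m → R n m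
      scopingR : ∀ {a b n m} → R a b → label a ≡ var n → label b ≡ var m → R n m

  -- Q⇓ : closure of Q under (↙), (↘), (↓)
  data Down (Q : Rel Node 0ℓ) : Rel Node 0ℓ where
    base : ∀ {a b} → Q a b → Down Q a b
    dL   : ∀ {a b n₁ n₂ m₁ m₂} → Down Q a b → label a ≡ app n₁ n₂ → label b ≡ app m₁ m₂ → Down Q n₁ m₁
    dR   : ∀ {a b n₁ n₂ m₁ m₂} → Down Q a b → label a ≡ app n₁ n₂ → label b ≡ app m₁ m₂ → Down Q n₂ m₂
    dAbs : ∀ {a b n m} → Down Q a b → label a ≡ abs n → label b ≡ abs m → Down Q n m

  -- Q# : closure of Q under reflexivity, symmetry, transitivity, (↙), (↘), (↓)
  data Sharp (Q : Rel Node 0ℓ) : Rel Node 0ℓ where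
    base  : ∀ {a b} → Q a b → Sharp Q a b
    refl′ : ∀ a → Sharp Q a a
    sym′  : ∀ {a b} → Sharp Q a b → Sharp Q b a
    trans′ : ∀ {a b c} → Sharp Q a b → Sharp Q b c → Sharp Q a c
    sL    : ∀ {a b n₁ n₂ m₁ m₂} → Sharp Q a b → label a ≡ app n₁ n₂ → label b ≡ app m₁ m₂ → Sharp Q n₁ m₁
    sR    : ∀ {a b n₁ n₂ m₁ m₂} → Sharp Q a b → label a ≡ app n₁ n₂ → label b ≡ app m₁ m₂ → Sharp Q n₂ m₂
    sAbs  : ∀ {a b n m} → Sharp Q a b → label a ≡ abs n → label b ≡ abs m → Sharp Q n m

module Submission where

-- (⇒) Bisimulations are stable under symmetric and reflexive-transitive closure, so the
--     equivalence closure of a bisimulation is one.  If Q⇓ is a bisimulation, its equivalence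
--     closure is an equivalence containing Q and closed under (↙), (↘), (↓); by minimality of Q#
--     it contains Q#, and conversely it is contained in Q#.  So Q# coincides with a bisimulation.
-- (⇐) Q⇓ ⊆ Q# gives homogeneity, and (↙), (↘), (↓) are constructors of Q⇓; only scoping needs
--     work.  Two graph facts are used.  First, no related pair x R y of a homogeneous relation
--     closed under (↙), (↘), (↓) has y strictly below x: transporting the path x ⇝⁺ y along R
--     yields an infinite descent, contradicting finiteness and acyclicity.  Second, each side of
--     a derivation of a Q⇓ b is a child path from a root, so by the scoping condition a binder
--     l of a must occur on the left side, paired with some y on the right side.  Given
--     Var(n) Q⇓ Var(m), we get n Q⇓ y with y and m both on the right side, hence equal or
--     comparable; comparability would give y Q# m with one strictly below the other.

open import Defs
open import Level using (0ℓ)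
open import Relation.Binary.Core using (Rel; _⇒_)
open import Relation.Binary.Structures using (IsEquivalence)
open import Relation.Binary.Construct.Closure.Symmetric using (SymClosure; fwd; bwd)
open import Relation.Binary.Construct.Closure.ReflexiveTransitive using (Star; ε; _◅_; return)
open import Relation.Binary.Construct.Closure.Equivalence as EqClosure using (EqClosure)
open import Function.Bundles using (_⇔_; mk⇔)
open import Data.Nat using (ℕ; zero; suc; _≤′_; ≤′-reflexive; ≤′-step)
open import Data.Nat.Properties using (n<1+n; <⇒<′)
open import Data.Fin using (toℕ; _≟_)
open import Data.Fin.Properties using (pigeonhole)
open import Data.Product using (_×_; _,_; ∃; ∃₂; proj₁; proj₂)
open import Data.Sum using (_⊎_; inj₁; inj₂)
open import Data.Empty using (⊥; ⊥-elim)
open import Relation.Nullary using (¬_; yes; no)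
open import Relation.Binary.PropositionalEquality using (_≡_; _≢_; refl; sym; trans; cong; subst)

module _ (G : PreGraph) where
  open PreGraph G

  app-partner : ∀ {a b n₁ n₂} → kind G (label a) ≡ kind G (label b) → label a ≡ app n₁ n₂ →
                ∃₂ λ m₁ m₂ → label b ≡ app m₁ m₂
  app-partner {b = b} k p with label b | trans (sym k) (cong (kind G) p)
  ... | app m₁ m₂ | _ = m₁ , m₂ , refl

  abs-partner : ∀ {a b n} → kind G (label a) ≡ kind G (label b) → label a ≡ abs n →
                ∃ λ m → label b ≡ abs m
  abs-partner {b = b} k p with label b | trans (sym k) (cong (kind G) p)
  ... | abs m | _ = m , refl

  var-partner : ∀ {a b n} → kind G (label a) ≡ kind G (label b) → label a ≡ var n →
                ∃ λ m → label b ≡ var m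
  var-partner {b = b} k p with label b | trans (sym k) (cong (kind G) p)
  ... | var m | _ = m , refl

  record DownwardClosed (R : Rel (Node G) 0ℓ) : Set where
    field
      closedL   : ∀ {a b n₁ n₂ m₁ m₂} → R a b → label a ≡ app n₁ n₂ → label b ≡ app m₁ m₂ → R n₁ m₁
      closedR   : ∀ {a b n₁ n₂ m₁ m₂} → R a b → label a ≡ app n₁ n₂ → label b ≡ app m₁ m₂ → R n₂ m₂
      closedAbs : ∀ {a b n m} → R a b → label a ≡ abs n → label b ≡ abs m → R n m

  bisim⇒downward : ∀ {R} → IsBisimulation G R → DownwardClosed R
  bisim⇒downward B = record { closedL = ruleL ; closedR = ruleR ; closedAbs = ruleAbs }
    where open IsBisimulation B

  bisim-transfer : ∀ {R R′ : Rel (Node G) 0ℓ} → R ⇒ R′ → R′ ⇒ R →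
                   IsBisimulation G R → IsBisimulation G R′
  bisim-transfer to from B = record
    { homogeneous = λ a b r → homogeneous a b (from r)
    ; ruleL       = λ r p q → to (ruleL (from r) p q)
    ; ruleR       = λ r p q → to (ruleR (from r) p q)
    ; ruleAbs     = λ r p q → to (ruleAbs (from r) p q)
    ; scopingR    = λ r p q → to (scopingR (from r) p q)
    }
    where open IsBisimulation B

  symClosure-bisim : ∀ {R} → IsBisimulation G R → IsBisimulation G (SymClosure R)
  symClosure-bisim {R} B = record
    { homogeneous = hom
    ; ruleL       = λ { (fwd r) p q → fwd (ruleL r p q) ; (bwd r) p q → bwd (ruleL r q p) }
    ; ruleR       = λ { (fwd r) p q → fwd (ruleR r p q) ; (bwd r) p q → bwd (ruleR r q p) }
    ; ruleAbs     = λ { (fwd r) p q → fwd (ruleAbs r p q) ; (bwd r) p q → bwd (ruleAbs r q p) }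
    ; scopingR    = λ { (fwd r) p q → fwd (scopingR r p q) ; (bwd r) p q → bwd (scopingR r q p) }
    }
    where
    open IsBisimulation B
    hom : Homogeneous G (SymClosure R)
    hom a b (fwd r) = homogeneous a b r
    hom a b (bwd r) = sym (homogeneous b a r)

  -- The reflexive-transitive closure of a bisimulation is a bisimulation: along a chain of
  -- related nodes all labels have the same shape, so the children form a chain as well.
  star-bisim : ∀ {R} → IsBisimulation G R → IsBisimulation G (Star R)
  star-bisim {R} B = record
    { homogeneous = hom ; ruleL = stepL ; ruleR = stepR ; ruleAbs = stepAbs ; scopingR = stepVar }
    where
    open IsBisimulation B

    hom : Homogeneous G (Star R)
    hom a b ε        = refl
    hom a b (r ◅ rs) = trans (homogeneous _ _ r) (hom _ _ rs)

    stepL : ∀ {a b n₁ n₂ m₁ m₂} → Star R a b → label a ≡ app n₁ n₂ → label b ≡ app m₁ m₂ → Star R n₁ m₁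
    stepL ε p q with trans (sym p) q
    ... | refl = ε
    stepL (r ◅ rs) p q with app-partner (homogeneous _ _ r) p
    ... | _ , _ , p′ = ruleL r p p′ ◅ stepL rs p′ q

    stepR : ∀ {a b n₁ n₂ m₁ m₂} → Star R a b → label a ≡ app n₁ n₂ → label b ≡ app m₁ m₂ → Star R n₂ m₂
    stepR ε p q with trans (sym p) q
    ... | refl = ε
    stepR (r ◅ rs) p q with app-partner (homogeneous _ _ r) p
    ... | _ , _ , p′ = ruleR r p p′ ◅ stepR rs p′ q

    stepAbs : ∀ {a b n m} → Star R a b → label a ≡ abs n → label b ≡ abs m → Star R n m
    stepAbs ε p q with trans (sym p) q
    ... | refl = ε
    stepAbs (r ◅ rs) p q with abs-partner (homogeneous _ _ r) p
    ... | _ , p′ = ruleAbs r p p′ ◅ stepAbs rs p′ q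

    stepVar : ∀ {a b n m} → Star R a b → label a ≡ var n → label b ≡ var m → Star R n m
    stepVar ε p q with trans (sym p) q
    ... | refl = ε
    stepVar (r ◅ rs) p q with var-partner (homogeneous _ _ r) p
    ... | _ , p′ = scopingR r p p′ ◅ stepVar rs p′ q

  eqClosure-bisim : ∀ {R} → IsBisimulation G R → IsBisimulation G (EqClosure R)
  eqClosure-bisim B = star-bisim (symClosure-bisim B)

  module _ {Q : Rel (Node G) 0ℓ} where

    down⊆sharp : Down G Q ⇒ Sharp G Q
    down⊆sharp (base q)     = base q
    down⊆sharp (dL d p q)   = sL (down⊆sharp d) p q
    down⊆sharp (dR d p q)   = sR (down⊆sharp d) p q
    down⊆sharp (dAbs d p q) = sAbs (down⊆sharp d) p q

    sharp-isEquivalence : IsEquivalence (Sharp G Q)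
    sharp-isEquivalence = record { refl = refl′ _ ; sym = sym′ ; trans = trans′ }

    sharp-least : ∀ {R} → IsEquivalence R → Q ⇒ R → DownwardClosed R → Sharp G Q ⇒ R
    sharp-least {R} E Q⊆R C = go
      where
      open IsEquivalence E renaming (refl to R-refl; sym to R-sym; trans to R-trans)
      open DownwardClosed C
      go : Sharp G Q ⇒ R
      go (base q)     = Q⊆R q
      go (refl′ a)    = R-refl
      go (sym′ s)     = R-sym (go s)
      go (trans′ s t) = R-trans (go s) (go t)
      go (sL s p q)   = closedL (go s) p q
      go (sR s p q)   = closedR (go s) p q
      go (sAbs s p q) = closedAbs (go s) p q

    down-bisim⇒sharp-bisim : IsBisimulation G (Down G Q) → IsBisimulation G (Sharp G Q)
    down-bisim⇒sharp-bisim B = bisim-transfer closure⊆sharp sharp⊆closure closure-bisim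
      where
      closure-bisim : IsBisimulation G (EqClosure (Down G Q))
      closure-bisim = eqClosure-bisim B
      closure⊆sharp : EqClosure (Down G Q) ⇒ Sharp G Q
      closure⊆sharp = EqClosure.fold sharp-isEquivalence down⊆sharp
      sharp⊆closure : Sharp G Q ⇒ EqClosure (Down G Q)
      sharp⊆closure = sharp-least (EqClosure.isEquivalence _) (λ q → return (fwd (base q)))
                                  (bisim⇒downward closure-bisim)

  reach-trans : ∀ {a b c} → Reach⁺ G a b → Reach⁺ G b c → Reach⁺ G a c
  reach-trans (one e)    r′ = step e r′
  reach-trans (step e r) r′ = step e (reach-trans r r′)

  avoiding-snoc : ∀ {l a b c} → PathAvoiding G l a b → Child G c b → c ≢ l → PathAvoiding G l a c
  avoiding-snoc (here a≢l)         e c≢l = step a≢l e (here c≢l)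
  avoiding-snoc (step a≢l e′ path) e c≢l = step a≢l e′ (avoiding-snoc path e c≢l)

  module _ {R : Rel (Node G) 0ℓ} (hom : Homogeneous G R) (C : DownwardClosed R) where
    open DownwardClosed C

    child-simulation : ∀ {x y c} → R x y → Child G c x → ∃ λ d → R c d × Child G d y
    child-simulation r (appL p) with app-partner (hom _ _ r) p
    ... | d , _ , q = d , closedL r p q , appL q
    child-simulation r (appR p) with app-partner (hom _ _ r) p
    ... | _ , d , q = d , closedR r p q , appR q
    child-simulation r (absB p) with abs-partner (hom _ _ r) p
    ... | d , q = d , closedAbs r p q , absB q

    path-simulation : ∀ {x y x′} → R x y → Reach⁺ G x x′ → ∃ λ y′ → R x′ y′ × Reach⁺ G y y′
    path-simulation r (one e) with child-simulation r e
    ... | d , r′ , e′ = d , r′ , one e′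
    path-simulation r (step e path) with child-simulation r e
    ... | d , r′ , e′ with path-simulation r′ path
    ...   | y′ , r″ , path′ = y′ , r″ , step e′ path′

    DescendingPair : Set
    DescendingPair = ∃₂ λ x y → R x y × Reach⁺ G x y

    top : DescendingPair → Node G
    top = proj₁

    shift : DescendingPair → DescendingPair
    shift (x , y , r , x⇝y) =
      let (y′ , r′ , y⇝y′) = path-simulation r x⇝y in y , y′ , r′ , y⇝y′

    descent : DescendingPair → ℕ → DescendingPair
    descent δ zero    = δ
    descent δ (suc k) = shift (descent δ k)

    descent-step : ∀ δ k → Reach⁺ G (top (descent δ k)) (top (descent δ (suc k)))
    descent-step δ k = proj₂ (proj₂ (proj₂ (descent δ k)))

    descent-reach : ∀ δ {i j} → suc i ≤′ j → Reach⁺ G (top (descent δ i)) (top (descent δ j))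
    descent-reach δ {i} (≤′-reflexive refl)  = descent-step δ i
    descent-reach δ {j = suc j} (≤′-step i<j) = reach-trans (descent-reach δ i<j) (descent-step δ j)

    -- In a finite acyclic graph the descent must repeat a node, closing a cycle.
    no-descent : (∀ a → ¬ Reach⁺ G a a) → ∀ {x y} → R x y → ¬ Reach⁺ G x y
    no-descent acyclic r x⇝y = cycle (_ , _ , r , x⇝y)
      where
      cycle : DescendingPair → ⊥
      cycle δ with i , j , i<j , same ← pigeonhole (n<1+n size) (λ i → top (descent δ (toℕ i)))
        = acyclic _ (subst (Reach⁺ G _) (sym same) (descent-reach δ (<⇒<′ i<j)))

  -- The two sides of a derivation of a Q⇓ b.
  data Side : Set where
    left right : Side

  pick : Side → Node G → Node G → Node G
  pick left  x y = x
  pick right x y = y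

  pick-child : ∀ s {x y a b} → Child G x a → Child G y b → Child G (pick s x y) (pick s a b)
  pick-child left  e _ = e
  pick-child right _ e = e

  module _ {Q : Rel (Node G) 0ℓ} where

    -- Along d x y: the pair (x , y) is the conclusion of a subderivation of d.
    data Along : ∀ {a b} → Down G Q a b → Node G → Node G → Set where
      here : ∀ {a b} {d : Down G Q a b} → Along d a b
      inL  : ∀ {a b n₁ n₂ m₁ m₂ x y} {d : Down G Q a b}
               {p : label a ≡ app n₁ n₂} {q : label b ≡ app m₁ m₂} → Along d x y → Along (dL d p q) x y
      inR  : ∀ {a b n₁ n₂ m₁ m₂ x y} {d : Down G Q a b}
               {p : label a ≡ app n₁ n₂} {q : label b ≡ app m₁ m₂} → Along d x y → Along (dR d p q) x y
      inA  : ∀ {a b n m x y} {d : Down G Q a b}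
               {p : label a ≡ abs n} {q : label b ≡ abs m} → Along d x y → Along (dAbs d p q) x y

    along-down : ∀ {a b x y} {d : Down G Q a b} → Along d x y → Down G Q x y
    along-down {d = d} here = d
    along-down (inL w)      = along-down w
    along-down (inR w)      = along-down w
    along-down (inA w)      = along-down w

    MeetsOrAvoids : Side → ∀ {a b} → Down G Q a b → Node G → Set
    MeetsOrAvoids s {a} {b} d l =
      (∃₂ λ x y → Along d x y × pick s x y ≡ l) ⊎ (∃ λ r → IsRoot G r × PathAvoiding G l r (pick s a b))

    meets-or-avoids-step : ∀ s {a b x y l} {d : Down G Q a b} {d′ : Down G Q x y} →
      MeetsOrAvoids s d l → Child G (pick s x y) (pick s a b) →
      (∀ {u v} → Along d u v → Along d′ u v) → MeetsOrAvoids s d′ l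
    meets-or-avoids-step s (inj₁ (u , v , w , eq)) _ lift = inj₁ (u , v , lift w , eq)
    meets-or-avoids-step s {x = x} {y} {l} (inj₂ (r , root , path)) e _ with pick s x y ≟ l
    ... | yes eq = inj₁ (x , y , here , eq)
    ... | no ne  = inj₂ (r , root , avoiding-snoc path e ne)

    -- Each side of a derivation is a child path starting at a root of the query.
    meets-or-avoids : IsQuery G Q → ∀ s {a b} (d : Down G Q a b) l → MeetsOrAvoids s d l
    meets-or-avoids IQ s (base {a} {b} q) l with pick s a b ≟ l
    ... | yes eq = inj₁ (a , b , here , eq)
    ... | no ne  = inj₂ (pick s a b , query-root s , here ne)
      where
      query-root : ∀ s → IsRoot G (pick s a b)
      query-root left  = proj₁ (IQ a b q)
      query-root right = proj₂ (IQ a b q)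
    meets-or-avoids IQ s (dL d p q) l =
      meets-or-avoids-step s (meets-or-avoids IQ s d l) (pick-child s (appL p) (appL q)) inL
    meets-or-avoids IQ s (dR d p q) l =
      meets-or-avoids-step s (meets-or-avoids IQ s d l) (pick-child s (appR p) (appR q)) inR
    meets-or-avoids IQ s (dAbs d p q) l =
      meets-or-avoids-step s (meets-or-avoids IQ s d l) (pick-child s (absB p) (absB q)) inA

    along-above : ∀ {a b x y c} {d : Down G Q a b} → Along d x y → Child G c b → Reach⁺ G y c
    along-above here e            = one e
    along-above (inL {q = q} w) e = reach-trans (along-above w (appL q)) (one e)
    along-above (inR {q = q} w) e = reach-trans (along-above w (appR q)) (one e)
    along-above (inA {q = q} w) e = reach-trans (along-above w (absB q)) (one e)

    along-comparable : ∀ {a b x y x′ y′} {d : Down G Q a b} → Along d x y → Along d x′ y′ →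
                       y ≡ y′ ⊎ Reach⁺ G y y′ ⊎ Reach⁺ G y′ y
    along-comparable here            here             = inj₁ refl
    along-comparable here            (inL {q = q} w′) = inj₂ (inj₂ (along-above w′ (appL q)))
    along-comparable here            (inR {q = q} w′) = inj₂ (inj₂ (along-above w′ (appR q)))
    along-comparable here            (inA {q = q} w′) = inj₂ (inj₂ (along-above w′ (absB q)))
    along-comparable (inL {q = q} w) here             = inj₂ (inj₁ (along-above w (appL q)))
    along-comparable (inR {q = q} w) here             = inj₂ (inj₁ (along-above w (appR q)))
    along-comparable (inA {q = q} w) here             = inj₂ (inj₁ (along-above w (absB q)))
    along-comparable (inL w)         (inL w′)         = along-comparable w w′
    along-comparable (inR w)         (inR w′)         = along-comparable w w′
    along-comparable (inA w)         (inA w′)         = along-comparable w w′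

    module _ (LG : IsLambdaGraph G) (IQ : IsQuery G Q) (B : IsBisimulation G (Sharp G Q)) where
      open IsLambdaGraph LG using (scoping; acyclic)
      open IsBisimulation B using (homogeneous; scopingR)

      sharp-no-descent : ∀ {x y} → Sharp G Q x y → ¬ Reach⁺ G x y
      sharp-no-descent = no-descent homogeneous (bisim⇒downward B) acyclic

      partner-related : ∀ {a b n m y} (d : Down G Q a b) → label a ≡ var n → label b ≡ var m →
                        Along d n y → Sharp G Q y m
      partner-related d p q w = trans′ (sym′ (down⊆sharp (along-down w))) (scopingR (down⊆sharp d) p q)

      -- Scoping for Q⇓: the binders n, m are met on the two sides of d (scoping condition),
      -- and the right partner y of n, being Q#-related to m, must be m itself.
      down-scoping : ∀ {a b n m} → Down G Q a b → label a ≡ var n → label b ≡ var m → Down G Q n m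
      down-scoping {a} {b} {n} {m} d p q
        with meets-or-avoids IQ left d n | meets-or-avoids IQ right d m
      ... | inj₂ (r , root , path) | _ = ⊥-elim (scoping r a n root p path)
      ... | _ | inj₂ (r , root , path) = ⊥-elim (scoping r b m root q path)
      ... | inj₁ (_ , _ , w , refl) | inj₁ (_ , _ , w′ , refl) with along-comparable w w′
      ...   | inj₁ refl        = along-down w
      ...   | inj₂ (inj₁ y⇝m) = ⊥-elim (sharp-no-descent (partner-related d p q w) y⇝m)
      ...   | inj₂ (inj₂ m⇝y) = ⊥-elim (sharp-no-descent (sym′ (partner-related d p q w)) m⇝y)

      sharp-bisim⇒down-bisim : IsBisimulation G (Down G Q)
      sharp-bisim⇒down-bisim = record
        { homogeneous = λ a b d → homogeneous a b (down⊆sharp d)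
        ; ruleL       = dL
        ; ruleR       = dR
        ; ruleAbs     = dAbs
        ; scopingR    = down-scoping
        }

mainTheorem12 : (G : PreGraph) → IsLambdaGraph G →
    (Q : Rel (Node G) 0ℓ) → IsQuery G Q →
    IsBisimulation G (Down G Q) ⇔ IsBisimulation G (Sharp G Q)
mainTheorem12 G LG Q IQ = mk⇔ (down-bisim⇒sharp-bisim G) (sharp-bisim⇒down-bisim G LG IQ)
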